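{- Let $\mathfrak G=(V,A)$ be a finite simple digraph of order $n\ge1$ and let $v\in V$. Then there exists a unique polynomial $T_{\mathfrak G,v}(X)\in\mathbb Q[X]$ with $\deg T_{\mathfrak G,v}\le n-1$ such that $$\sum_{i=0}^{\infty}\frac{\sigma(\mathfrak G_i)}{i!}X^i=T_{\mathfrak G,v}(X)\exp(X).$$ Moreover, these polynomials satisfy $T_{P_1,v}(X)=1$ (where $P_1$ is the one-vertex digraph with vertex $v$) and, for $n\ge 2$, $$\frac{d}{dX}T_{\mathfrak G,v}(X)=\sum_{w\in\min(\mathfrak G)\setminus\{v\}}\Big(T_{\mathfrak G-w,v}(X)+\frac{d}{dX}T_{\mathfrak G-w,v}(X)\Big),\qquad T_{\mathfrak G,v}(0)=\sigma(\mathfrak G).$$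
   Context: A simple digraph has a finite vertex set and arc set $A\subseteq V\times V$ with no loops. If $|V|=n$, a disposition is a bijection $f:V\to\{1,\dots,n\}$ with $f(v_1)>f(v_2)$ whenever $(v_1,v_2)\in A$, and $\sigma(\mathfrak G)$ is the number of dispositions. $\min(\mathfrak G)$ is the set of vertices $u$ with no outgoing arc; $\mathfrak G-w$ is the subdigraph induced by $V\setminus\{w\}$. For $i\ge0$, $\mathfrak G_i$ is the digraph obtained from $\mathfrak G$ by adding $i$ new vertices $z_1,\dots,z_i$ and the arcs $(z_0,z_1),(z_1,z_2),\dots,(z_{i-1},z_i)$, where $z_0=v$ (so $\mathfrak G_0=\mathfrak G$). -}

module Defs where

open import Data.Bool using (Bool; true; false; _∧_; if_then_else_)
open import Data.Nat as ℕ using (ℕ; zero; suc; _∸_; _!)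
open import Data.Nat.Properties using (_!≢0)
open import Data.Fin as Fin using (Fin; zero; suc; toℕ; punchIn; punchOut; splitAt; _<_)
open import Data.Fin.Properties using (all?; any?; _≟_; _<?_)
open import Data.Sum using (inj₁; inj₂)
open import Data.Product using (Σ; ∃; _×_; _,_)
open import Data.List as List using (List; []; _∷_; length; filter; concatMap; allFin)
open import Data.Rational as ℚ using (ℚ; 0ℚ; 1ℚ; _+_; _*_; _/_)
open import Data.Integer using (+_)
open import Relation.Binary.PropositionalEquality using (_≡_; _≢_)
open import Relation.Nullary using (Dec; yes; no; ¬_)
open import Relation.Nullary.Decidable using (_×-dec_; _→-dec_)
import Data.Bool.Properties as BoolP

-- Digraphs on the vertex set Fin n.  (a , b) is an arc iff G a b ≡ true.

Digraph : ℕ → Set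
Digraph n = Fin n → Fin n → Bool

-- simple = no loops (A ⊆ V × V already excludes multiple arcs)
Simple : ∀ {n} → Digraph n → Set
Simple {n} G = ∀ (i : Fin n) → G i i ≡ false

Injective : ∀ {n} → (Fin n → Fin n) → Set
Injective {n} f = ∀ (i j : Fin n) → f i ≡ f j → i ≡ j

Surjective : ∀ {n} → (Fin n → Fin n) → Set
Surjective {n} f = ∀ (y : Fin n) → ∃ λ x → f x ≡ y

IsDisposition : ∀ {n} → Digraph n → (Fin n → Fin n) → Set
IsDisposition {n} G f =
  (Injective f × Surjective f) × (∀ (a b : Fin n) → G a b ≡ true → f b < f a)

isDisposition? : ∀ {n} (G : Digraph n) (f : Fin n → Fin n) → Dec (IsDisposition G f)
isDisposition? G f =
  ((all? λ i → all? λ j → (f i ≟ f j) →-dec (i ≟ j))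
   ×-dec (all? λ y → any? λ x → f x ≟ y))
  ×-dec (all? λ a → all? λ b → (G a b BoolP.≟ true) →-dec (f b <? f a))

cons : ∀ {n m} → Fin m → (Fin n → Fin m) → Fin (suc n) → Fin m
cons k f zero = k
cons k f (suc i) = f i

allFuns : ∀ n m → List (Fin n → Fin m)
allFuns zero m = (λ ()) ∷ []
allFuns (suc n) m = concatMap (λ f → List.map (λ k → cons k f) (allFin m)) (allFuns n m)

σ : ∀ {n} → Digraph n → ℕ
σ {n} G = length (filter (isDisposition? G) (allFuns n n))

IsMin : ∀ {n} → Digraph n → Fin n → Set
IsMin {n} G u = ∀ (x : Fin n) → G u x ≡ false

isMin? : ∀ {n} (G : Digraph n) (u : Fin n) → Dec (IsMin G u)
isMin? G u = all? λ x → G u x BoolP.≟ false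

-- G - w : induced subdigraph on V \ {w}, vertices relabelled via punchIn w
_─_ : ∀ {n} → Digraph (suc n) → Fin (suc n) → Digraph n
(G ─ w) a b = G (punchIn w a) (punchIn w b)

-- G_i : add vertices z₁..zᵢ (z_j is the vertex n + (j-1)) and arcs
-- (z₀ , z₁), …, (z_{i-1} , zᵢ), where z₀ = v.
eqFin : ∀ {n} → Fin n → Fin n → Bool
eqFin a b with a ≟ b
... | yes _ = true
... | no  _ = false

eqℕ : ℕ → ℕ → Bool
eqℕ a b with a ℕ.≟ b
... | yes _ = true
... | no  _ = false

ext : ∀ {n} → Digraph n → Fin n → (i : ℕ) → Digraph (n ℕ.+ i)
ext {n} G v i a b with splitAt n a | splitAt n b
... | inj₁ x | inj₁ y = G x y
... | inj₁ x | inj₂ q = eqFin x v ∧ eqℕ (toℕ q) 0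
... | inj₂ p | inj₁ y = false
... | inj₂ p | inj₂ q = eqℕ (toℕ q) (suc (toℕ p))

-- Polynomials over ℚ as coefficient sequences (coefficient of X^k).

Poly : Set
Poly = ℕ → ℚ

DegLe : Poly → ℕ → Set
DegLe p d = ∀ k → d ℕ.< k → p k ≡ 0ℚ

sumTo : ℕ → (ℕ → ℚ) → ℚ
sumTo zero f = f 0
sumTo (suc i) f = sumTo i f + f (suc i)

invFact : ℕ → ℚ
invFact m = (+ 1 / (m !)) {{m !≢0}}

-- coefficient of X^i in p(X) · exp(X)
timesExpCoeff : Poly → ℕ → ℚ
timesExpCoeff p i = sumTo i (λ k → p k * invFact (i ∸ k))

deriv : Poly → Poly
deriv p k = (+ suc k / 1) * p (suc k)

const : ℚ → Poly
const c zero = c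
const c (suc k) = 0ℚ

IsT : ∀ {n} → Digraph (suc n) → Fin (suc n) → Poly → Set
IsT {n} G v p =
  DegLe p n × (∀ i → (+ σ (ext G v i) / (i !)) {{i !≢0}} ≡ timesExpCoeff p i)

sumFin : ∀ {m} → (Fin m → ℚ) → ℚ
sumFin {zero} f = 0ℚ
sumFin {suc m} f = f zero + sumFin (λ i → f (suc i))

-- summand of the recurrence: for w ∈ min(G) \ {v}, coefficient k of
-- T_{G-w,v} + T'_{G-w,v}; zero otherwise.  v is relabelled in G - w
-- as punchOut (w ≢ v).
recSummand : ∀ {m} → (T : Digraph (suc m) → Fin (suc m) → Poly) →
             Digraph (suc (suc m)) → Fin (suc (suc m)) → Fin (suc (suc m)) → ℕ → ℚ
recSummand T G v w k with isMin? G w | w ≟ v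
... | yes _ | no w≢v = T (G ─ w) (punchOut w≢v) k + deriv (T (G ─ w) (punchOut w≢v)) k
... | _     | _      = 0ℚ

P₁ : Digraph 1
P₁ a b = false

ℕ→ℚ : ℕ → ℚ
ℕ→ℚ m = + m / 1

-- In a disposition, the vertex labelled 1 has no outgoing arc and the remaining labels form a
-- disposition of the rest, so σ(G) = Σ_{w ∈ min G} σ(G - w). The minimal vertices of G_{i+1} are
-- z_{i+1} and those of min(G) ∖ {v}, with G_{i+1} - z_{i+1} = G_i and G_{i+1} - w = (G - w)_{i+1}, so
--   σ(G_{i+1}) = σ(G_i) + Σ_{w ∈ min(G) ∖ {v}} σ((G - w)_{i+1}).
-- Because (p e^X)' = (p' + p) e^X and dropping the constant term of an EGF differentiates it, this
-- identity says: if T(0) = σ(G) and T' = Σ_w (T_{G-w,v} + T'_{G-w,v}), where each T_{G-w,v} e^X is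
-- the EGF of σ((G - w)_i), then T e^X is the EGF of σ(G_i). So T_{G,v} is obtained by integrating
-- the recurrence, by induction on n. It is unique because the coefficients of p e^X determine p(0)
-- and those of p' e^X.

{-# OPTIONS --safe #-}
module Submission where

open import Defs
open import Data.Nat using (ℕ; suc)
open import Data.Fin using (Fin; zero)
open import Data.Product using (Σ; _×_)
open import Data.Rational using (ℚ; 1ℚ)
open import Relation.Binary.PropositionalEquality using (_≡_)

open import Algebra.Bundles using (Ring; CommutativeMonoid)
import Algebra.Properties.CommutativeSemigroup as CommutativeSemigroupProperties
import Algebra.Properties.Group as GroupProperties
import Algebra.Properties.Semiring.Sum as SemiringSum
open import Data.Bool using (true; false; _∧_)
open import Data.Fin as Fin using (suc; punchIn; punchOut; toℕ; _↑ˡ_; _↑ʳ_; inject₁; fromℕ; cast)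
import Data.Fin.Properties as Fin
import Data.Integer as ℤ
import Data.Integer.Properties as ℤ
open import Data.List as List using (List; []; _∷_; length; filter; map; concatMap; tabulate; allFin)
import Data.List.Properties as List
open import Data.Nat.ListAction using () renaming (sum to sumList)
open import Data.Nat.ListAction.Properties using () renaming (sum-++ to sumList-++)
open import Data.Nat as ℕ using (zero; _∸_; _!; _≤_; z≤n; s≤s; NonZero)
import Data.Nat.Properties as ℕ
open import Data.Nat.Properties using (_!≢0)
open import Data.Nat.Tactic.RingSolver using (solve-∀)
open import Data.Product using (_,_; proj₁; proj₂)
open import Data.Rational as ℚ using (0ℚ; fromℚᵘ)
import Data.Rational.Properties as ℚ
open import Data.Rational.Unnormalised as ℚᵘ using (mkℚᵘ; *≡*)
import Data.Rational.Unnormalised.Properties as ℚᵘ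
open import Data.Vec.Functional using (insertAt)
open import Data.Vec.Functional.Properties using (insertAt-lookup; insertAt-punchIn)
open import Function using (_∘_; _⇔_; mk⇔; Equivalence)
open import Relation.Binary.PropositionalEquality
  using (_≢_; _≗_; refl; sym; trans; cong; cong₂; subst; subst₂; module ≡-Reasoning)
open import Relation.Nullary using (Dec; yes; no; ¬_; ¬?; contradiction)
open import Relation.Nullary.Decidable using (dec-yes; dec-no; _×-dec_)

module ℕΣ = SemiringSum ℕ.+-*-semiring
module ℚΣ = SemiringSum (Ring.semiring ℚ.+-*-ring)

module Counting where

  open import Data.Nat using (_+_; _*_)
  open import Data.Fin using (_<_)
  open ℕΣ using (sum; sum-cong-≗; sum-remove; sum-replicate-zero; sum-init-last; ∑-comm; *-distribˡ-sum; *-distribʳ-sum)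

  𝟙 : ∀ {p} {P : Set p} → Dec P → ℕ
  𝟙 (yes _) = 1
  𝟙 (no _)  = 0

  module _ {p} {P : Set p} where

    𝟙-yes : (P? : Dec P) → P → 𝟙 P? ≡ 1
    𝟙-yes P? p = cong 𝟙 (proj₂ (dec-yes P? p))

    𝟙-no : (P? : Dec P) → ¬ P → 𝟙 P? ≡ 0
    𝟙-no P? ¬p = cong 𝟙 (dec-no P? ¬p)

    𝟙-absorbˡ : ∀ (P? : Dec P) c → (P → c ≡ 1) → 𝟙 P? ≡ c * 𝟙 P?
    𝟙-absorbˡ (yes p) c c≡1 = sym (trans (ℕ.*-identityʳ c) (c≡1 p))
    𝟙-absorbˡ (no _)  c _   = sym (ℕ.*-zeroʳ c)

    module _ {q} {Q : Set q} where

      𝟙-cong : (P? : Dec P) (Q? : Dec Q) → P ⇔ Q → 𝟙 P? ≡ 𝟙 Q?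
      𝟙-cong (yes _) (yes _) _   = refl
      𝟙-cong (no _)  (no _)  _   = refl
      𝟙-cong (yes p) (no ¬q) P⇔Q = contradiction (Equivalence.to P⇔Q p) ¬q
      𝟙-cong (no ¬p) (yes q) P⇔Q = contradiction (Equivalence.from P⇔Q q) ¬p

      𝟙-× : (P? : Dec P) (Q? : Dec Q) → 𝟙 (P? ×-dec Q?) ≡ 𝟙 P? * 𝟙 Q?
      𝟙-× (yes _) (yes _) = refl
      𝟙-× (yes _) (no _)  = refl
      𝟙-× (no _)  _       = refl

  ∑-single : ∀ {m} (x : Fin (suc m) → ℕ) i → (∀ j → x (punchIn i j) ≡ 0) → sum x ≡ x i
  ∑-single {m} x i x-off-i = begin
    sum x                                   ≡⟨ sum-remove {i = i} x ⟩
    x i + sum (x ∘ punchIn i)               ≡⟨ cong (x i +_) (trans (sum-cong-≗ x-off-i) (sum-replicate-zero m)) ⟩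
    x i + 0                                 ≡⟨ ℕ.+-identityʳ (x i) ⟩
    x i                                     ∎
    where open ≡-Reasoning

  data PunchInView {n} (w : Fin (suc n)) : Fin (suc n) → Set where
    pivot   : PunchInView w w
    punched : (a : Fin n) → PunchInView w (punchIn w a)

  punchInView : ∀ {n} (w x : Fin (suc n)) → PunchInView w x
  punchInView w x with w Fin.≟ x
  ... | yes refl = pivot
  ... | no w≢x   = subst (PunchInView w) (Fin.punchIn-punchOut w≢x) (punched (punchOut w≢x))

  insertAt-cong : ∀ {n m} (w : Fin (suc n)) (k : Fin m) {g g′ : Fin n → Fin m} → g ≗ g′ →
                  insertAt g w k ≗ insertAt g′ w k
  insertAt-cong w k {g} {g′} g≗g′ x with punchInView w x
  ... | pivot     = trans (insertAt-lookup g w k) (sym (insertAt-lookup g′ w k))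
  ... | punched a = trans (insertAt-punchIn g w k a) (trans (g≗g′ a) (sym (insertAt-punchIn g′ w k a)))

  -- Functions built with cons or insertAt agree only pointwise, so summands have to respect _≗_.
  Extensional : ∀ {n m} → ((Fin n → Fin m) → ℕ) → Set
  Extensional F = ∀ {f g} → f ≗ g → F f ≡ F g

  cons-cong : ∀ {n m} (k : Fin m) {g g′ : Fin n → Fin m} → g ≗ g′ → cons k g ≗ cons k g′
  cons-cong k g≗g′ zero    = refl
  cons-cong k g≗g′ (suc a) = g≗g′ a

  sumFuns : ∀ n m → ((Fin n → Fin m) → ℕ) → ℕ
  sumFuns zero    m F = F (λ ())
  sumFuns (suc n) m F = sumFuns n m (λ g → sum (λ k → F (cons k g)))

  length-filter≡sum-𝟙 : ∀ {a p} {A : Set a} {P : A → Set p} (P? : ∀ x → Dec (P x)) xs →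
                  length (filter P? xs) ≡ sumList (map (𝟙 ∘ P?) xs)
  length-filter≡sum-𝟙 P? []       = refl
  length-filter≡sum-𝟙 P? (x ∷ xs) with P? x
  ... | yes _ = cong suc (length-filter≡sum-𝟙 P? xs)
  ... | no _  = length-filter≡sum-𝟙 P? xs

  sum-map-concatMap : ∀ {a b} {A : Set a} {B : Set b} (F : B → ℕ) (h : A → List B) xs →
    sumList (map F (concatMap h xs)) ≡ sumList (map (sumList ∘ map F ∘ h) xs)
  sum-map-concatMap F h []       = refl
  sum-map-concatMap F h (x ∷ xs) = begin
    sumList (map F (h x List.++ concatMap h xs))            ≡⟨ cong sumList (List.map-++ F (h x) _) ⟩
    sumList (map F (h x) List.++ map F (concatMap h xs))    ≡⟨ sumList-++ (map F (h x)) _ ⟩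
    sumList (map F (h x)) + sumList (map F (concatMap h xs)) ≡⟨ cong (sumList (map F (h x)) +_) (sum-map-concatMap F h xs) ⟩
    sumList (map F (h x)) + sumList (map (sumList ∘ map F ∘ h) xs) ∎
    where open ≡-Reasoning

  sum-map-tabulate : ∀ {a} {A : Set a} {m} (F : A → ℕ) (g : Fin m → A) →
                     sumList (map F (tabulate g)) ≡ sum (F ∘ g)
  sum-map-tabulate {m = zero}  F g = refl
  sum-map-tabulate {m = suc m} F g = cong (F (g zero) +_) (sum-map-tabulate F (g ∘ suc))

  sum-map-allFuns : ∀ n m (F : (Fin n → Fin m) → ℕ) → Extensional F →
                    sumList (map F (allFuns n m)) ≡ sumFuns n m F
  sum-map-allFuns zero    m F F-ext = trans (ℕ.+-identityʳ _) (F-ext (λ ()))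
  sum-map-allFuns (suc n) m F F-ext = begin
    sumList (map F (allFuns (suc n) m))
      ≡⟨ sum-map-concatMap F _ (allFuns n m) ⟩
    sumList (map (λ g → sumList (map F (map (λ k → cons k g) (allFin m)))) (allFuns n m))
      ≡⟨ cong sumList (List.map-cong (λ g → cong sumList (sym (List.map-∘ (allFin m)))) (allFuns n m)) ⟩
    sumList (map (λ g → sumList (map (λ k → F (cons k g)) (allFin m))) (allFuns n m))
      ≡⟨ cong sumList (List.map-cong (λ g → sum-map-tabulate (λ k → F (cons k g)) (λ k → k)) (allFuns n m)) ⟩
    sumList (map (λ g → sum (λ k → F (cons k g))) (allFuns n m))
      ≡⟨ sum-map-allFuns n m _ (λ g≗g′ → sum-cong-≗ (λ k → F-ext (cons-cong k g≗g′))) ⟩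
    sumFuns (suc n) m F ∎
    where open ≡-Reasoning

  sumFuns-cong : ∀ n m {F G : (Fin n → Fin m) → ℕ} → (∀ f → F f ≡ G f) → sumFuns n m F ≡ sumFuns n m G
  sumFuns-cong zero    m F≗G = F≗G _
  sumFuns-cong (suc n) m F≗G = sumFuns-cong n m (λ g → sum-cong-≗ (λ k → F≗G (cons k g)))

  sumFuns-∑-comm : ∀ n m {k} (F : Fin k → (Fin n → Fin m) → ℕ) →
                   sumFuns n m (λ f → sum (λ w → F w f)) ≡ sum (λ w → sumFuns n m (F w))
  sumFuns-∑-comm zero    m F = refl
  sumFuns-∑-comm (suc n) m F = begin
    sumFuns n m (λ g → sum (λ j → sum (λ w → F w (cons j g))))
      ≡⟨ sumFuns-cong n m (λ g → ∑-comm (λ j w → F w (cons j g))) ⟩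
    sumFuns n m (λ g → sum (λ w → sum (λ j → F w (cons j g))))
      ≡⟨ sumFuns-∑-comm n m (λ w g → sum (λ j → F w (cons j g))) ⟩
    sum (λ w → sumFuns (suc n) m (F w)) ∎
    where open ≡-Reasoning

  sumFuns-*-distribˡ : ∀ n m c (F : (Fin n → Fin m) → ℕ) → sumFuns n m (λ f → c * F f) ≡ c * sumFuns n m F
  sumFuns-*-distribˡ zero    m c F = refl
  sumFuns-*-distribˡ (suc n) m c F = begin
    sumFuns n m (λ g → sum (λ j → c * F (cons j g)))
      ≡⟨ sumFuns-cong n m (λ g → sym (*-distribˡ-sum c (λ j → F (cons j g)))) ⟩
    sumFuns n m (λ g → c * sum (λ j → F (cons j g)))
      ≡⟨ sumFuns-*-distribˡ n m c _ ⟩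
    c * sumFuns (suc n) m F ∎
    where open ≡-Reasoning

  sumFuns-insertAt : ∀ n m (w : Fin (suc n)) F → Extensional F →
                     sumFuns (suc n) m F ≡ sum (λ k → sumFuns n m (λ g → F (insertAt g w k)))
  sumFuns-insertAt n m zero F F-ext = begin
    sumFuns n m (λ g → sum (λ k → F (cons k g)))
      ≡⟨ sumFuns-cong n m (λ g → sum-cong-≗ (λ k → F-ext (cons≗insertAt₀ k g))) ⟩
    sumFuns n m (λ g → sum (λ k → F (insertAt g zero k)))
      ≡⟨ sumFuns-∑-comm n m (λ k g → F (insertAt g zero k)) ⟩
    sum (λ k → sumFuns n m (λ g → F (insertAt g zero k))) ∎
    where
    open ≡-Reasoning
    cons≗insertAt₀ : ∀ k g → cons k g ≗ insertAt g zero k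
    cons≗insertAt₀ k g zero    = refl
    cons≗insertAt₀ k g (suc a) = refl
  sumFuns-insertAt (suc n) m (suc w) F F-ext = begin
    sumFuns (suc n) m (λ g → sum (λ j → F (cons j g)))
      ≡⟨ sumFuns-insertAt n m w _ (λ g≗g′ → sum-cong-≗ (λ j → F-ext (cons-cong j g≗g′))) ⟩
    sum (λ k → sumFuns n m (λ g → sum (λ j → F (cons j (insertAt g w k)))))
      ≡⟨ sum-cong-≗ (λ k → sumFuns-cong n m (λ g → sum-cong-≗ (λ j → F-ext (cons≗insertAt k j g)))) ⟩
    sum (λ k → sumFuns (suc n) m (λ g → F (insertAt g (suc w) k)))  ∎
    where
    open ≡-Reasoning
    cons≗insertAt : ∀ k j g → cons j (insertAt g w k) ≗ insertAt (cons j g) (suc w) k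
    cons≗insertAt k j g zero    = refl
    cons≗insertAt k j g (suc a) = refl

  sumFuns-fix : ∀ n m (w : Fin (suc n)) (k₀ : Fin (suc m)) F → Extensional F →
                sumFuns (suc n) (suc m) (λ f → 𝟙 (f w Fin.≟ k₀) * F f) ≡ sumFuns n (suc m) (λ g → F (insertAt g w k₀))
  sumFuns-fix n m w k₀ F F-ext = begin
    sumFuns (suc n) (suc m) (λ f → 𝟙 (f w Fin.≟ k₀) * F f)
      ≡⟨ sumFuns-insertAt n (suc m) w _ (λ f≗g → cong₂ _*_ (cong (λ x → 𝟙 (x Fin.≟ k₀)) (f≗g w)) (F-ext f≗g)) ⟩
    sum (λ k → sumFuns n (suc m) (λ g → 𝟙 (insertAt g w k w Fin.≟ k₀) * F (insertAt g w k)))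
      ≡⟨ sum-cong-≗ (λ k → sumFuns-cong n (suc m) (λ g →
           cong (λ x → 𝟙 (x Fin.≟ k₀) * F (insertAt g w k)) (insertAt-lookup g w k))) ⟩
    sum (λ k → sumFuns n (suc m) (λ g → 𝟙 (k Fin.≟ k₀) * F (insertAt g w k)))
      ≡⟨ sum-cong-≗ (λ k → sumFuns-*-distribˡ n (suc m) (𝟙 (k Fin.≟ k₀)) (λ g → F (insertAt g w k))) ⟩
    sum (λ k → 𝟙 (k Fin.≟ k₀) * Fix k)
      ≡⟨ ∑-single (λ k → 𝟙 (k Fin.≟ k₀) * Fix k) k₀ (λ j →
           cong (_* Fix (punchIn k₀ j)) (𝟙-no (punchIn k₀ j Fin.≟ k₀) (Fin.punchInᵢ≢i k₀ j))) ⟩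
    𝟙 (k₀ Fin.≟ k₀) * Fix k₀
      ≡⟨ cong (_* Fix k₀) (𝟙-yes (k₀ Fin.≟ k₀) refl) ⟩
    1 * Fix k₀
      ≡⟨ ℕ.*-identityˡ (Fix k₀) ⟩
    Fix k₀ ∎
    where
    open ≡-Reasoning
    Fix : Fin (suc m) → ℕ
    Fix k = sumFuns n (suc m) (λ g → F (insertAt g w k))

  sumFuns-restrict : ∀ n m F → Extensional F → (∀ g a → g a ≡ zero → F g ≡ 0) →
                     sumFuns n (suc m) F ≡ sumFuns n m (λ h → F (suc ∘ h))
  sumFuns-restrict zero    m F F-ext _ = F-ext (λ ())
  sumFuns-restrict (suc n) m F F-ext F-vanish = begin
    sumFuns n (suc m) (λ g → sum (λ k → F (cons k g)))
      ≡⟨ sumFuns-restrict n m _ (λ g≗g′ → sum-cong-≗ (λ k → F-ext (cons-cong k g≗g′))) vanish ⟩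
    sumFuns n m (λ h → F (cons zero (suc ∘ h)) + sum (λ k → F (cons (suc k) (suc ∘ h))))
      ≡⟨ sumFuns-cong n m (λ h → cong₂ _+_ (F-vanish _ zero refl) (sum-cong-≗ (λ k → F-ext (cons-suc k h)))) ⟩
    sumFuns (suc n) m (λ h → F (suc ∘ h)) ∎
    where
    open ≡-Reasoning
    vanish : ∀ g a → g a ≡ zero → sum (λ k → F (cons k g)) ≡ 0
    vanish g a ga≡0 = trans (sum-cong-≗ (λ k → F-vanish (cons k g) (suc a) ga≡0)) (sum-replicate-zero (suc m))
    cons-suc : ∀ k h → cons (suc k) (suc ∘ h) ≗ suc ∘ cons k h
    cons-suc k h zero    = refl
    cons-suc k h (suc a) = refl

  IsDisposition-resp-≗ : ∀ {n} (G : Digraph n) {f g} → f ≗ g → IsDisposition G f → IsDisposition G g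
  IsDisposition-resp-≗ G {f} {g} f≗g ((f-inj , f-surj) , f-arcs) = (g-inj , g-surj) , g-arcs
    where
    g-inj : Injective g
    g-inj x y gx≡gy = f-inj x y (trans (f≗g x) (trans gx≡gy (sym (f≗g y))))
    g-surj : Surjective g
    g-surj y = let x , fx≡y = f-surj y in x , trans (sym (f≗g x)) fx≡y
    g-arcs : ∀ a b → G a b ≡ true → g b < g a
    g-arcs a b arc = subst₂ _<_ (f≗g b) (f≗g a) (f-arcs a b arc)

  𝟙-isDisposition-extensional : ∀ {n} (G : Digraph n) → Extensional (𝟙 ∘ isDisposition? G)
  𝟙-isDisposition-extensional G {f} {g} f≗g = 𝟙-cong (isDisposition? G f) (isDisposition? G g)
    (mk⇔ (IsDisposition-resp-≗ G f≗g) (IsDisposition-resp-≗ G (sym ∘ f≗g)))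

  ∑-𝟙-preimage : ∀ {n} {f : Fin (suc n) → Fin (suc n)} → Injective f → Surjective f →
                 ∀ y → sum (λ w → 𝟙 (f w Fin.≟ y)) ≡ 1
  ∑-𝟙-preimage {f = f} f-inj f-surj y with f-surj y
  ... | x , fx≡y = trans (∑-single (λ w → 𝟙 (f w Fin.≟ y)) x others) (𝟙-yes (f x Fin.≟ y) fx≡y)
    where
    others : ∀ j → 𝟙 (f (punchIn x j) Fin.≟ y) ≡ 0
    others j = 𝟙-no (f (punchIn x j) Fin.≟ y) (λ fj≡y → Fin.punchInᵢ≢i x j (f-inj _ _ (trans fj≡y (sym fx≡y))))

  insertAt-zero-not-injective : ∀ {n} (w : Fin (suc n)) (g : Fin n → Fin (suc n)) a → g a ≡ zero →
                                ¬ Injective (insertAt g w zero)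
  insertAt-zero-not-injective w g a ga≡0 inj = Fin.punchInᵢ≢i w a
    (inj _ _ (trans (insertAt-punchIn g w zero a) (trans ga≡0 (sym (insertAt-lookup g w zero)))))

  -- The least label (zero) can only sit on a vertex w without outgoing arcs, and the other labels
  -- form a disposition of G - w.
  module _ {n} (G : Digraph (suc n)) (w : Fin (suc n)) (h : Fin n → Fin n) where

    private
      f : Fin (suc n) → Fin (suc n)
      f = insertAt (suc ∘ h) w zero
      f-pivot : f w ≡ zero
      f-pivot = insertAt-lookup (suc ∘ h) w zero
      f-punched : ∀ a → f (punchIn w a) ≡ suc (h a)
      f-punched = insertAt-punchIn (suc ∘ h) w zero

    disposition-split : IsDisposition G f → IsMin G w × IsDisposition (G ─ w) h
    disposition-split ((f-inj , f-surj) , f-arcs) = w-min , (h-inj , h-surj) , h-arcs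
      where
      w-min : IsMin G w
      w-min x with G w x in arc
      ... | true  = contradiction (subst (f x <_) f-pivot (f-arcs w x arc)) λ ()
      ... | false = refl
      h-inj : Injective h
      h-inj a b ha≡hb = Fin.punchIn-injective w a b
        (f-inj _ _ (trans (f-punched a) (trans (cong suc ha≡hb) (sym (f-punched b)))))
      h-surj : Surjective h
      h-surj y with f-surj (suc y)
      ... | x , fx≡y with punchInView w x
      ...   | pivot     = contradiction (trans (sym f-pivot) fx≡y) λ ()
      ...   | punched a = a , Fin.suc-injective (trans (sym (f-punched a)) fx≡y)
      h-arcs : ∀ a b → (G ─ w) a b ≡ true → h b < h a
      h-arcs a b arc = ℕ.≤-pred (subst₂ _<_ (f-punched b) (f-punched a) (f-arcs _ _ arc))

    disposition-join : IsMin G w × IsDisposition (G ─ w) h → IsDisposition G f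
    disposition-join (w-min , (h-inj , h-surj) , h-arcs) = (f-inj , f-surj) , f-arcs
      where
      f-inj : Injective f
      f-inj x y fx≡fy with punchInView w x | punchInView w y
      ... | pivot     | pivot     = refl
      ... | pivot     | punched b = contradiction (trans (sym f-pivot) (trans fx≡fy (f-punched b))) λ ()
      ... | punched a | pivot     = contradiction (trans (sym f-pivot) (trans (sym fx≡fy) (f-punched a))) λ ()
      ... | punched a | punched b =
        cong (punchIn w) (h-inj a b (Fin.suc-injective (trans (sym (f-punched a)) (trans fx≡fy (f-punched b)))))
      f-surj : Surjective f
      f-surj zero    = w , f-pivot
      f-surj (suc y) = let a , ha≡y = h-surj y in punchIn w a , trans (f-punched a) (cong suc ha≡y)
      f-arcs : ∀ a b → G a b ≡ true → f b < f a
      f-arcs a b arc with punchInView w a | punchInView w b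
      ... | pivot      | _          = contradiction (trans (sym arc) (w-min b)) λ ()
      ... | punched a′ | pivot      = subst₂ _<_ (sym f-pivot) (sym (f-punched a′)) (s≤s z≤n)
      ... | punched a′ | punched b′ = subst₂ _<_ (sym (f-punched b′)) (sym (f-punched a′)) (s≤s (h-arcs a′ b′ arc))

    𝟙-disposition-split : 𝟙 (isDisposition? G f) ≡ 𝟙 (isMin? G w) * 𝟙 (isDisposition? (G ─ w) h)
    𝟙-disposition-split = trans (𝟙-cong (isDisposition? G f) (isMin? G w ×-dec isDisposition? (G ─ w) h)
                                         (mk⇔ disposition-split disposition-join))
                                (𝟙-× (isMin? G w) (isDisposition? (G ─ w) h))

  σ≡sumFuns : ∀ {n} (G : Digraph n) → σ G ≡ sumFuns n n (𝟙 ∘ isDisposition? G)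
  σ≡sumFuns {n} G = trans (length-filter≡sum-𝟙 (isDisposition? G) (allFuns n n))
                          (sum-map-allFuns n n _ (𝟙-isDisposition-extensional G))

  σ-rec : ∀ {n} (G : Digraph (suc n)) → σ G ≡ sum (λ w → 𝟙 (isMin? G w) * σ (G ─ w))
  σ-rec {n} G = begin
    σ G                                                                 ≡⟨ σ≡sumFuns G ⟩
    sumFuns (suc n) (suc n) D                                           ≡⟨ sumFuns-cong (suc n) (suc n) D≡∑ ⟩
    sumFuns (suc n) (suc n) (λ f → sum (λ w → 𝟙 (f w Fin.≟ zero) * D f)) ≡⟨ sumFuns-∑-comm (suc n) (suc n) (λ w f → 𝟙 (f w Fin.≟ zero) * D f) ⟩
    sum (λ w → sumFuns (suc n) (suc n) (λ f → 𝟙 (f w Fin.≟ zero) * D f)) ≡⟨ sum-cong-≗ removeMinimum ⟩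
    sum (λ w → 𝟙 (isMin? G w) * σ (G ─ w))                              ∎
    where
    open ≡-Reasoning
    D : (Fin (suc n) → Fin (suc n)) → ℕ
    D = 𝟙 ∘ isDisposition? G

    D≡∑ : ∀ f → 𝟙 (isDisposition? G f) ≡ sum (λ w → 𝟙 (f w Fin.≟ zero) * 𝟙 (isDisposition? G f))
    D≡∑ f = trans (𝟙-absorbˡ (isDisposition? G f) _ (λ ((f-inj , f-surj) , _) → ∑-𝟙-preimage f-inj f-surj zero))
                  (*-distribʳ-sum (𝟙 (isDisposition? G f)) (λ w → 𝟙 (f w Fin.≟ zero)))

    removeMinimum : ∀ w → sumFuns (suc n) (suc n) (λ f → 𝟙 (f w Fin.≟ zero) * D f) ≡ 𝟙 (isMin? G w) * σ (G ─ w)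
    removeMinimum w = begin
      sumFuns (suc n) (suc n) (λ f → 𝟙 (f w Fin.≟ zero) * D f)
        ≡⟨ sumFuns-fix n n w zero D (𝟙-isDisposition-extensional G) ⟩
      sumFuns n (suc n) (λ g → D (insertAt g w zero))
        ≡⟨ sumFuns-restrict n n _ (𝟙-isDisposition-extensional G ∘ insertAt-cong w zero) vanish ⟩
      sumFuns n n (λ h → D (insertAt (suc ∘ h) w zero))
        ≡⟨ sumFuns-cong n n (𝟙-disposition-split G w) ⟩
      sumFuns n n (λ h → 𝟙 (isMin? G w) * 𝟙 (isDisposition? (G ─ w) h))
        ≡⟨ sumFuns-*-distribˡ n n (𝟙 (isMin? G w)) _ ⟩
      𝟙 (isMin? G w) * sumFuns n n (𝟙 ∘ isDisposition? (G ─ w))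
        ≡⟨ cong (𝟙 (isMin? G w) *_) (σ≡sumFuns (G ─ w)) ⟨
      𝟙 (isMin? G w) * σ (G ─ w) ∎
      where
      vanish : ∀ g a → g a ≡ zero → D (insertAt g w zero) ≡ 0
      vanish g a ga≡0 = 𝟙-no (isDisposition? G _) (insertAt-zero-not-injective w g a ga≡0 ∘ proj₁ ∘ proj₁)

  data SplitView (m k : ℕ) : Fin (m + k) → Set where
    left  : (x : Fin m) → SplitView m k (x ↑ˡ k)
    right : (q : Fin k) → SplitView m k (m ↑ʳ q)

  splitView : ∀ m k a → SplitView m k a
  splitView zero    k a       = right a
  splitView (suc m) k zero    = left zero
  splitView (suc m) k (suc a) with splitView m k a
  ... | left x  = left (suc x)
  ... | right q = right q

  sum-split : ∀ m k (f : Fin (m + k) → ℕ) → sum f ≡ sum (f ∘ (_↑ˡ k)) + sum (f ∘ (m ↑ʳ_))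
  sum-split zero    k f = refl
  sum-split (suc m) k f = trans (cong (f zero +_) (sum-split m k (f ∘ suc))) (sym (ℕ.+-assoc (f zero) _ _))

  eqℕ-refl : ∀ a → eqℕ a a ≡ true
  eqℕ-refl a with a ℕ.≟ a
  ... | yes _ = refl
  ... | no a≢a = contradiction refl a≢a

  eqℕ-≢ : ∀ {a b} → a ≢ b → eqℕ a b ≡ false
  eqℕ-≢ {a} {b} a≢b with a ℕ.≟ b
  ... | yes a≡b = contradiction a≡b a≢b
  ... | no _    = refl

  eqFin-refl : ∀ {n} (a : Fin n) → eqFin a a ≡ true
  eqFin-refl a with a Fin.≟ a
  ... | yes _ = refl
  ... | no a≢a = contradiction refl a≢a

  eqFin-≢ : ∀ {n} {a b : Fin n} → a ≢ b → eqFin a b ≡ false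
  eqFin-≢ {a = a} {b} a≢b with a Fin.≟ b
  ... | yes a≡b = contradiction a≡b a≢b
  ... | no _    = refl

  eqFin-punchIn : ∀ {n} {x v : Fin (suc n)} (x≢v : x ≢ v) (a : Fin n) → eqFin (punchIn x a) v ≡ eqFin a (punchOut x≢v)
  eqFin-punchIn {x = x} {v} x≢v a with punchIn x a Fin.≟ v | a Fin.≟ punchOut x≢v
  ... | yes _  | yes _  = refl
  ... | no _   | no _   = refl
  ... | yes xa≡v | no a≢v′ = contradiction (trans (sym (Fin.punchOut-punchIn x)) (Fin.punchOut-cong x xa≡v)) a≢v′
  ... | no xa≢v  | yes a≡v′ = contradiction (trans (cong (punchIn x) a≡v′) (Fin.punchIn-punchOut x≢v)) xa≢v

  module _ {n} (G : Digraph n) (v : Fin n) (k : ℕ) where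

    ext-↑ˡ-↑ˡ : ∀ x y → ext G v k (x ↑ˡ k) (y ↑ˡ k) ≡ G x y
    ext-↑ˡ-↑ˡ x y rewrite Fin.splitAt-↑ˡ n x k | Fin.splitAt-↑ˡ n y k = refl

    ext-↑ˡ-↑ʳ : ∀ x q → ext G v k (x ↑ˡ k) (n ↑ʳ q) ≡ (eqFin x v ∧ eqℕ (toℕ q) 0)
    ext-↑ˡ-↑ʳ x q rewrite Fin.splitAt-↑ˡ n x k | Fin.splitAt-↑ʳ n k q = refl

    ext-↑ʳ-↑ˡ : ∀ p y → ext G v k (n ↑ʳ p) (y ↑ˡ k) ≡ false
    ext-↑ʳ-↑ˡ p y rewrite Fin.splitAt-↑ʳ n k p | Fin.splitAt-↑ˡ n y k = refl

    ext-↑ʳ-↑ʳ : ∀ p q → ext G v k (n ↑ʳ p) (n ↑ʳ q) ≡ eqℕ (toℕ q) (suc (toℕ p))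
    ext-↑ʳ-↑ʳ p q rewrite Fin.splitAt-↑ʳ n k p | Fin.splitAt-↑ʳ n k q = refl

  σ-cong : ∀ {n} {A B : Digraph n} → (∀ a b → A a b ≡ B a b) → σ A ≡ σ B
  σ-cong {n} {A} {B} A≗B = begin
    σ A                                  ≡⟨ σ≡sumFuns A ⟩
    sumFuns n n (𝟙 ∘ isDisposition? A)   ≡⟨ sumFuns-cong n n (λ f → 𝟙-cong (isDisposition? A f) (isDisposition? B f)
                                              (mk⇔ (transport A≗B) (transport (λ a b → sym (A≗B a b))))) ⟩
    sumFuns n n (𝟙 ∘ isDisposition? B)   ≡⟨ σ≡sumFuns B ⟨
    σ B                                  ∎
    where
    open ≡-Reasoning
    transport : ∀ {A B : Digraph n} {f} → (∀ a b → A a b ≡ B a b) → IsDisposition A f → IsDisposition B f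
    transport A≗B (bij , arcs) = bij , λ a b arc → arcs a b (trans (A≗B a b) arc)

  σ-cast : ∀ {m n} (eq : m ≡ n) (A : Digraph m) (B : Digraph n) →
           (∀ a b → B (cast eq a) (cast eq b) ≡ A a b) → σ B ≡ σ A
  σ-cast refl A B B≗A = σ-cong (λ a b → trans (sym (cong₂ B (Fin.cast-is-id refl a) (Fin.cast-is-id refl b))) (B≗A a b))

  σ-ext-zero : ∀ {n} (G : Digraph n) v → σ (ext G v 0) ≡ σ G
  σ-ext-zero {n} G v = σ-cast (sym (ℕ.+-identityʳ n)) G (ext G v 0)
    (λ a b → trans (cong₂ (ext G v 0) (cast≡↑ˡ a) (cast≡↑ˡ b)) (ext-↑ˡ-↑ˡ G v 0 a b))
    where
    cast≡↑ˡ : ∀ a → cast (sym (ℕ.+-identityʳ n)) a ≡ a ↑ˡ 0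
    cast≡↑ˡ a = Fin.toℕ-injective (trans (Fin.toℕ-cast _ a) (sym (Fin.toℕ-↑ˡ a 0)))

  -- The counting analogue of recSummand.
  minDeletionCount : ∀ {n} → Digraph (suc n) → Fin (suc n) → Fin (suc n) → ℕ → ℕ
  minDeletionCount G v w i with isMin? G w | w Fin.≟ v
  ... | yes _ | no w≢v = σ (ext (G ─ w) (punchOut w≢v) (suc i))
  ... | _     | _      = 0

  module _ {n} (G : Digraph (suc n)) (v w : Fin (suc n)) where

    minDeletionCount-min : IsMin G w → (w≢v : w ≢ v) →
                           ∀ i → minDeletionCount G v w i ≡ σ (ext (G ─ w) (punchOut w≢v) (suc i))
    minDeletionCount-min w-min w≢v i with isMin? G w | w Fin.≟ v
    ... | yes _   | no w≢v′ = cong (λ j → σ (ext (G ─ w) j (suc i))) (Fin.punchOut-cong w refl)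
    ... | yes _   | yes w≡v = contradiction w≡v w≢v
    ... | no ¬min | _       = contradiction w-min ¬min

    minDeletionCount-other : ¬ (IsMin G w × w ≢ v) → ∀ i → minDeletionCount G v w i ≡ 0
    minDeletionCount-other ¬min-other i with isMin? G w | w Fin.≟ v
    ... | yes w-min | no w≢v = contradiction (w-min , w≢v) ¬min-other
    ... | yes _     | yes _  = refl
    ... | no _      | _      = refl

  punchIn-↑ˡ : ∀ {n} k (x : Fin (suc n)) (a : Fin n) → punchIn (x ↑ˡ k) (a ↑ˡ k) ≡ punchIn x a ↑ˡ k
  punchIn-↑ˡ k zero    a       = refl
  punchIn-↑ˡ k (suc x) zero    = refl
  punchIn-↑ˡ k (suc x) (suc a) = cong suc (punchIn-↑ˡ k x a)

  punchIn-↑ʳ : ∀ {n} k (x : Fin (suc n)) (q : Fin k) → punchIn (x ↑ˡ k) (n ↑ʳ q) ≡ suc n ↑ʳ q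
  punchIn-↑ʳ         k zero    q = refl
  punchIn-↑ʳ {suc n} k (suc x) q = cong suc (punchIn-↑ʳ k x q)

  punchIn≡inject₁ : ∀ {n} (w : Fin (suc n)) (j : Fin n) → toℕ j ℕ.< toℕ w → punchIn w j ≡ inject₁ j
  punchIn≡inject₁ (suc w) zero    _           = refl
  punchIn≡inject₁ (suc w) (suc j) (s≤s j<w) = cong suc (punchIn≡inject₁ w j j<w)

  module _ {n} (G : Digraph (suc n)) (v : Fin (suc n)) (i : ℕ) where

    private
      H : Digraph (suc n + suc i)
      H = ext G v (suc i)

      last : Fin (suc n + suc i)
      last = suc n ↑ʳ fromℕ i

    isMin-↑ˡ⇔ : ∀ x → IsMin H (x ↑ˡ suc i) ⇔ (IsMin G x × x ≢ v)
    isMin-↑ˡ⇔ x = mk⇔ (λ min → restrict min , ≢v min) join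
      where
      restrict : IsMin H (x ↑ˡ suc i) → IsMin G x
      restrict min y = trans (sym (ext-↑ˡ-↑ˡ G v (suc i) x y)) (min (y ↑ˡ suc i))
      ≢v : IsMin H (x ↑ˡ suc i) → x ≢ v
      ≢v min refl = contradiction (trans (sym arc) (min (suc n ↑ʳ zero))) λ ()
        where
        arc : H (x ↑ˡ suc i) (suc n ↑ʳ zero) ≡ true
        arc = trans (ext-↑ˡ-↑ʳ G v (suc i) x zero) (cong (_∧ true) (eqFin-refl x))
      join : IsMin G x × x ≢ v → IsMin H (x ↑ˡ suc i)
      join (x-min , x≢v) b with splitView (suc n) (suc i) b
      ... | left y  = trans (ext-↑ˡ-↑ˡ G v (suc i) x y) (x-min y)
      ... | right q = trans (ext-↑ˡ-↑ʳ G v (suc i) x q) (cong (_∧ eqℕ (toℕ q) 0) (eqFin-≢ x≢v))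

    ext-delete-↑ˡ : ∀ x (x≢v : x ≢ v) a b → (H ─ (x ↑ˡ suc i)) a b ≡ ext (G ─ x) (punchOut x≢v) (suc i) a b
    ext-delete-↑ˡ x x≢v a b with splitView n (suc i) a | splitView n (suc i) b
    ... | left a′  | left b′  = trans (cong₂ H (punchIn-↑ˡ (suc i) x a′) (punchIn-↑ˡ (suc i) x b′))
        (trans (ext-↑ˡ-↑ˡ G v (suc i) (punchIn x a′) (punchIn x b′)) (sym (ext-↑ˡ-↑ˡ (G ─ x) (punchOut x≢v) (suc i) a′ b′)))
    ... | left a′  | right q  = trans (cong₂ H (punchIn-↑ˡ (suc i) x a′) (punchIn-↑ʳ (suc i) x q))
        (trans (ext-↑ˡ-↑ʳ G v (suc i) (punchIn x a′) q) (trans (cong (_∧ eqℕ (toℕ q) 0) (eqFin-punchIn x≢v a′))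
          (sym (ext-↑ˡ-↑ʳ (G ─ x) (punchOut x≢v) (suc i) a′ q))))
    ... | right p  | left b′  = trans (cong₂ H (punchIn-↑ʳ (suc i) x p) (punchIn-↑ˡ (suc i) x b′))
        (trans (ext-↑ʳ-↑ˡ G v (suc i) p (punchIn x b′)) (sym (ext-↑ʳ-↑ˡ (G ─ x) (punchOut x≢v) (suc i) p b′)))
    ... | right p  | right q  = trans (cong₂ H (punchIn-↑ʳ (suc i) x p) (punchIn-↑ʳ (suc i) x q))
        (trans (ext-↑ʳ-↑ʳ G v (suc i) p q) (sym (ext-↑ʳ-↑ʳ (G ─ x) (punchOut x≢v) (suc i) p q)))

    ↑ˡ-term : ∀ x → 𝟙 (isMin? H (x ↑ˡ suc i)) * σ (H ─ (x ↑ˡ suc i)) ≡ minDeletionCount G v x i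
    ↑ˡ-term x with isMin? G x | x Fin.≟ v | isMin? H (x ↑ˡ suc i)
    ... | yes _     | no x≢v  | yes _   = trans (ℕ.*-identityˡ _) (σ-cong (ext-delete-↑ˡ x x≢v))
    ... | yes x-min | no x≢v  | no ¬min = contradiction (Equivalence.from (isMin-↑ˡ⇔ x) (x-min , x≢v)) ¬min
    ... | yes _     | yes x≡v | yes min = contradiction x≡v (proj₂ (Equivalence.to (isMin-↑ˡ⇔ x) min))
    ... | yes _     | yes _   | no _    = refl
    ... | no ¬x-min | _       | yes min = contradiction (proj₁ (Equivalence.to (isMin-↑ˡ⇔ x) min)) ¬x-min
    ... | no _      | _       | no _    = refl

    ¬isMin-↑ʳ-inject₁ : ∀ q → ¬ IsMin H (suc n ↑ʳ inject₁ q)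
    ¬isMin-↑ʳ-inject₁ q min = contradiction (trans (sym arc) (min (suc n ↑ʳ suc q))) λ ()
      where
      arc : H (suc n ↑ʳ inject₁ q) (suc n ↑ʳ suc q) ≡ true
      arc = trans (ext-↑ʳ-↑ʳ G v (suc i) (inject₁ q) (suc q))
                  (trans (cong (λ t → eqℕ (suc (toℕ q)) (suc t)) (Fin.toℕ-inject₁ q)) (eqℕ-refl _))

    isMin-last : IsMin H last
    isMin-last b with splitView (suc n) (suc i) b
    ... | left y  = ext-↑ʳ-↑ˡ G v (suc i) (fromℕ i) y
    ... | right q = trans (ext-↑ʳ-↑ʳ G v (suc i) (fromℕ i) q)
                        (eqℕ-≢ (λ q≡1+i → ℕ.<-irrefl (trans q≡1+i (cong suc (Fin.toℕ-fromℕ i))) (Fin.toℕ<n q)))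

    ext-delete-last : σ (H ─ last) ≡ σ (ext G v i)
    ext-delete-last = σ-cast eq (ext G v i) (H ─ last) relabel
      where
      eq : suc n + i ≡ n + suc i
      eq = sym (ℕ.+-suc n i)

      embed : ∀ c t → toℕ c ≡ toℕ t → punchIn last (cast eq c) ≡ t
      embed c t c≡t = Fin.toℕ-injective (begin
        toℕ (punchIn last (cast eq c))  ≡⟨ cong toℕ (punchIn≡inject₁ last (cast eq c) c<last) ⟩
        toℕ (inject₁ (cast eq c))       ≡⟨ Fin.toℕ-inject₁ (cast eq c) ⟩
        toℕ (cast eq c)                 ≡⟨ Fin.toℕ-cast eq c ⟩
        toℕ c                           ≡⟨ c≡t ⟩
        toℕ t                           ∎)
        where
        open ≡-Reasoning
        c<last : toℕ (cast eq c) ℕ.< toℕ last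
        c<last = subst₂ ℕ._<_ (sym (Fin.toℕ-cast eq c))
          (sym (trans (Fin.toℕ-↑ʳ (suc n) (fromℕ i)) (cong (suc n +_) (Fin.toℕ-fromℕ i)))) (Fin.toℕ<n c)

      embed-↑ˡ : ∀ x → punchIn last (cast eq (x ↑ˡ i)) ≡ x ↑ˡ suc i
      embed-↑ˡ x = embed (x ↑ˡ i) (x ↑ˡ suc i) (trans (Fin.toℕ-↑ˡ x i) (sym (Fin.toℕ-↑ˡ x (suc i))))

      embed-↑ʳ : ∀ q → punchIn last (cast eq (suc n ↑ʳ q)) ≡ suc n ↑ʳ inject₁ q
      embed-↑ʳ q = embed (suc n ↑ʳ q) (suc n ↑ʳ inject₁ q) (trans (Fin.toℕ-↑ʳ (suc n) q)
        (sym (trans (Fin.toℕ-↑ʳ (suc n) (inject₁ q)) (cong (suc n +_) (Fin.toℕ-inject₁ q)))))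

      relabel : ∀ a b → (H ─ last) (cast eq a) (cast eq b) ≡ ext G v i a b
      relabel a b with splitView (suc n) i a | splitView (suc n) i b
      ... | left x  | left y  = trans (cong₂ H (embed-↑ˡ x) (embed-↑ˡ y))
          (trans (ext-↑ˡ-↑ˡ G v (suc i) x y) (sym (ext-↑ˡ-↑ˡ G v i x y)))
      ... | left x  | right q = trans (cong₂ H (embed-↑ˡ x) (embed-↑ʳ q))
          (trans (ext-↑ˡ-↑ʳ G v (suc i) x (inject₁ q))
          (trans (cong (λ t → eqFin x v ∧ eqℕ t 0) (Fin.toℕ-inject₁ q)) (sym (ext-↑ˡ-↑ʳ G v i x q))))
      ... | right p | left y  = trans (cong₂ H (embed-↑ʳ p) (embed-↑ˡ y))
          (trans (ext-↑ʳ-↑ˡ G v (suc i) (inject₁ p) y) (sym (ext-↑ʳ-↑ˡ G v i p y)))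
      ... | right p | right q = trans (cong₂ H (embed-↑ʳ p) (embed-↑ʳ q))
          (trans (ext-↑ʳ-↑ʳ G v (suc i) (inject₁ p) (inject₁ q))
          (trans (cong₂ (λ s t → eqℕ s (suc t)) (Fin.toℕ-inject₁ q) (Fin.toℕ-inject₁ p)) (sym (ext-↑ʳ-↑ʳ G v i p q))))

    ↑ʳ-terms : sum (λ q → 𝟙 (isMin? H (suc n ↑ʳ q)) * σ (H ─ (suc n ↑ʳ q))) ≡ σ (ext G v i)
    ↑ʳ-terms = begin
      sum (λ q → 𝟙 (isMin? H (suc n ↑ʳ q)) * σ (H ─ (suc n ↑ʳ q)))
        ≡⟨ sum-init-last (λ q → 𝟙 (isMin? H (suc n ↑ʳ q)) * σ (H ─ (suc n ↑ʳ q))) ⟩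
      sum (λ q → 𝟙 (isMin? H (suc n ↑ʳ inject₁ q)) * σ (H ─ (suc n ↑ʳ inject₁ q))) + 𝟙 (isMin? H last) * σ (H ─ last)
        ≡⟨ cong₂ _+_ (trans (sum-cong-≗ (λ q → cong (_* σ (H ─ (suc n ↑ʳ inject₁ q))) (𝟙-no (isMin? H (suc n ↑ʳ inject₁ q)) (¬isMin-↑ʳ-inject₁ q))))
                            (sum-replicate-zero i))
                     (trans (cong (_* σ (H ─ last)) (𝟙-yes (isMin? H last) isMin-last)) (ℕ.*-identityˡ (σ (H ─ last)))) ⟩
      0 + σ (H ─ last)
        ≡⟨ ext-delete-last ⟩
      σ (ext G v i) ∎
      where open ≡-Reasoning

    σ-ext-suc : σ (ext G v (suc i)) ≡ σ (ext G v i) + sum (λ w → minDeletionCount G v w i)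
    σ-ext-suc = begin
      σ H                                                               ≡⟨ σ-rec H ⟩
      sum term                                                          ≡⟨ sum-split (suc n) (suc i) term ⟩
      sum (λ (x : Fin (suc n)) → term (x ↑ˡ suc i)) + sum (term ∘ (suc n ↑ʳ_))
                                                                        ≡⟨ cong₂ _+_ (sum-cong-≗ ↑ˡ-term) ↑ʳ-terms ⟩
      sum (λ w → minDeletionCount G v w i) + σ (ext G v i)              ≡⟨ ℕ.+-comm (sum (λ w → minDeletionCount G v w i)) _ ⟩
      σ (ext G v i) + sum (λ w → minDeletionCount G v w i)              ∎
      where
      open ≡-Reasoning
      term : Fin (suc n + suc i) → ℕ
      term w = 𝟙 (isMin? H w) * σ (H ─ w)

module TimesExp where

  open import Data.Integer using (+_)
  open import Data.Rational using (_+_; _*_; _/_)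
  open GroupProperties ℚ.+-0-group using (∙-cancelʳ)
  open CommutativeSemigroupProperties (CommutativeMonoid.commutativeSemigroup ℚ.*-1-commutativeMonoid)
    using (x∙yz≈y∙xz)
  open CommutativeSemigroupProperties (CommutativeMonoid.commutativeSemigroup ℚ.+-0-commutativeMonoid)
    using () renaming (interchange to +-interchange)

  fromℚᵘ-homo-* : ∀ p q → fromℚᵘ p * fromℚᵘ q ≡ fromℚᵘ (p ℚᵘ.* q)
  fromℚᵘ-homo-* p q = ℚ.toℚᵘ-injective (ℚᵘ.≃-trans (ℚ.toℚᵘ-homo-* (fromℚᵘ p) (fromℚᵘ q))
    (ℚᵘ.≃-trans (ℚᵘ.*-cong (ℚ.toℚᵘ-fromℚᵘ p) (ℚ.toℚᵘ-fromℚᵘ q)) (ℚᵘ.≃-sym (ℚ.toℚᵘ-fromℚᵘ (p ℚᵘ.* q)))))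

  fromℚᵘ-homo-+ : ∀ p q → fromℚᵘ p + fromℚᵘ q ≡ fromℚᵘ (p ℚᵘ.+ q)
  fromℚᵘ-homo-+ p q = ℚ.toℚᵘ-injective (ℚᵘ.≃-trans (ℚ.toℚᵘ-homo-+ (fromℚᵘ p) (fromℚᵘ q))
    (ℚᵘ.≃-trans (ℚᵘ.+-cong (ℚ.toℚᵘ-fromℚᵘ p) (ℚ.toℚᵘ-fromℚᵘ q)) (ℚᵘ.≃-sym (ℚ.toℚᵘ-fromℚᵘ (p ℚᵘ.+ q)))))

  -- + a / suc b reduces to fromℚᵘ (mkℚᵘ (+ a) b), so fraction laws reduce to those of ℚᵘ.
  /-≡-cross : ∀ a b c d .{{_ : NonZero b}} .{{_ : NonZero d}} → a ℕ.* d ≡ c ℕ.* b → + a / b ≡ + c / d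
  /-≡-cross a (suc b) c (suc d) eq = ℚ.fromℚᵘ-cong {mkℚᵘ (+ a) b} {mkℚᵘ (+ c) d} (*≡* (begin
    + a ℤ.* + suc d   ≡⟨ ℤ.pos-* a (suc d) ⟨
    + (a ℕ.* suc d)   ≡⟨ cong +_ eq ⟩
    + (c ℕ.* suc b)   ≡⟨ ℤ.pos-* c (suc b) ⟩
    + c ℤ.* + suc b   ∎))
    where open ≡-Reasoning

  /-*-/ : ∀ a b c d .{{_ : NonZero b}} .{{_ : NonZero d}} →
        (+ a / b) * (+ c / d) ≡ (+ (a ℕ.* c) / (b ℕ.* d)) {{ℕ.m*n≢0 b d}}
  /-*-/ a (suc b) c (suc d) =
    trans (fromℚᵘ-homo-* (mkℚᵘ (+ a) b) (mkℚᵘ (+ c) d)) (ℚ./-cong (sym (ℤ.pos-* a c)) refl)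

  /-+-/ : ∀ a b c d .{{_ : NonZero b}} .{{_ : NonZero d}} →
        (+ a / b) + (+ c / d) ≡ (+ (a ℕ.* d ℕ.+ c ℕ.* b) / (b ℕ.* d)) {{ℕ.m*n≢0 b d}}
  /-+-/ a (suc b) c (suc d) = trans (fromℚᵘ-homo-+ (mkℚᵘ (+ a) b) (mkℚᵘ (+ c) d))
    (ℚ./-cong (sym (trans (ℤ.pos-+ (a ℕ.* suc d) (c ℕ.* suc b)) (cong₂ ℤ._+_ (ℤ.pos-* a (suc d)) (ℤ.pos-* c (suc b))))) refl)

  egfCoeff : ℕ → ℕ → ℚ
  egfCoeff a i = (+ a / i !) {{i !≢0}}

  egfCoeff-+ : ∀ a b i → egfCoeff (a ℕ.+ b) i ≡ egfCoeff a i + egfCoeff b i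
  egfCoeff-+ a b i = sym (trans (/-+-/ a (i !) b (i !) {{i !≢0}} {{i !≢0}})
    (/-≡-cross (a ℕ.* i ! ℕ.+ b ℕ.* i !) (i ! ℕ.* i !) (a ℕ.+ b) (i !)
      {{ℕ.m*n≢0 (i !) (i !) {{i !≢0}} {{i !≢0}}}} {{i !≢0}} (cross a b (i !))))
    where
    cross : ∀ a b d → (a ℕ.* d ℕ.+ b ℕ.* d) ℕ.* d ≡ (a ℕ.+ b) ℕ.* (d ℕ.* d)
    cross = solve-∀

  ℕ→ℚ-+ : ∀ a b → ℕ→ℚ (a ℕ.+ b) ≡ ℕ→ℚ a + ℕ→ℚ b
  ℕ→ℚ-+ a b = egfCoeff-+ a b 0

  suc-*-egfCoeff : ∀ a i → ℕ→ℚ (suc i) * egfCoeff a (suc i) ≡ egfCoeff a i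
  suc-*-egfCoeff a i = trans (/-*-/ (suc i) 1 a (suc i !) {{_}} {{suc i !≢0}})
    (/-≡-cross (suc i ℕ.* a) (1 ℕ.* suc i !) a (i !)
      {{ℕ.m*n≢0 1 (suc i !) {{_}} {{suc i !≢0}}}} {{i !≢0}} (cross a (suc i) (i !)))
    where
    cross : ∀ a m d → (m ℕ.* a) ℕ.* d ≡ a ℕ.* (1 ℕ.* (m ℕ.* d))
    cross = solve-∀

  ℕ→ℚ-suc-*-inverse : ∀ k → ℕ→ℚ (suc k) * (+ 1 / suc k) ≡ 1ℚ
  ℕ→ℚ-suc-*-inverse k = trans (/-*-/ (suc k) 1 1 (suc k)) (/-≡-cross (suc k ℕ.* 1) (1 ℕ.* suc k) 1 1 (cross (suc k)))
    where
    cross : ∀ m → (m ℕ.* 1) ℕ.* 1 ≡ 1 ℕ.* (1 ℕ.* m)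
    cross = solve-∀

  ℕ→ℚ-suc-*-cancelˡ : ∀ k {x y} → ℕ→ℚ (suc k) * x ≡ ℕ→ℚ (suc k) * y → x ≡ y
  ℕ→ℚ-suc-*-cancelˡ k {x} {y} eq = begin
    x                                   ≡⟨ cancel x ⟨
    (+ 1 / suc k) * (ℕ→ℚ (suc k) * x)   ≡⟨ cong ((+ 1 / suc k) *_) eq ⟩
    (+ 1 / suc k) * (ℕ→ℚ (suc k) * y)   ≡⟨ cancel y ⟩
    y                                   ∎
    where
    open ≡-Reasoning
    cancel : ∀ z → (+ 1 / suc k) * (ℕ→ℚ (suc k) * z) ≡ z
    cancel z = begin
      (+ 1 / suc k) * (ℕ→ℚ (suc k) * z)  ≡⟨ ℚ.*-assoc (+ 1 / suc k) (ℕ→ℚ (suc k)) z ⟨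
      (+ 1 / suc k) * ℕ→ℚ (suc k) * z    ≡⟨ cong (_* z) (trans (ℚ.*-comm (+ 1 / suc k) (ℕ→ℚ (suc k))) (ℕ→ℚ-suc-*-inverse k)) ⟩
      1ℚ * z                              ≡⟨ ℚ.*-identityˡ z ⟩
      z                                   ∎

  sumFin≡∑ : ∀ {m} (f : Fin m → ℚ) → sumFin f ≡ ℚΣ.sum f
  sumFin≡∑ {zero}  f = refl
  sumFin≡∑ {suc m} f = cong (_+_ (f zero)) (sumFin≡∑ (f ∘ suc))

  sumTo-cong : ∀ i {f g : ℕ → ℚ} → (∀ k → k ≤ i → f k ≡ g k) → sumTo i f ≡ sumTo i g
  sumTo-cong zero    f≗g = f≗g 0 z≤n
  sumTo-cong (suc i) f≗g = cong₂ _+_ (sumTo-cong i (λ k k≤i → f≗g k (ℕ.m≤n⇒m≤1+n k≤i))) (f≗g (suc i) ℕ.≤-refl)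

  sumTo-distrib-+ : ∀ i f g → sumTo i (λ k → f k + g k) ≡ sumTo i f + sumTo i g
  sumTo-distrib-+ zero    f g = refl
  sumTo-distrib-+ (suc i) f g =
    trans (cong (_+ (f (suc i) + g (suc i))) (sumTo-distrib-+ i f g)) (+-interchange (sumTo i f) (sumTo i g) (f (suc i)) (g (suc i)))

  *-distribˡ-sumTo : ∀ i c f → c * sumTo i f ≡ sumTo i (λ k → c * f k)
  *-distribˡ-sumTo zero    c f = refl
  *-distribˡ-sumTo (suc i) c f = trans (ℚ.*-distribˡ-+ c _ _) (cong (_+ c * f (suc i)) (*-distribˡ-sumTo i c f))

  sumTo-zero : ∀ i → sumTo i (λ _ → 0ℚ) ≡ 0ℚ
  sumTo-zero zero    = refl
  sumTo-zero (suc i) = trans (ℚ.+-identityʳ _) (sumTo-zero i)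

  sumTo-unshift : ∀ i f → sumTo (suc i) f ≡ f 0 + sumTo i (f ∘ suc)
  sumTo-unshift zero    f = refl
  sumTo-unshift (suc i) f = trans (cong (_+ f (suc (suc i))) (sumTo-unshift i f)) (ℚ.+-assoc (f 0) _ _)

  sumTo-∑-comm : ∀ {m} i (h : ℕ → Fin m → ℚ) →
                 sumTo i (λ k → ℚΣ.sum (h k)) ≡ ℚΣ.sum (λ w → sumTo i (λ k → h k w))
  sumTo-∑-comm zero    h = refl
  sumTo-∑-comm (suc i) h = trans (cong (_+ ℚΣ.sum (h (suc i))) (sumTo-∑-comm i h))
    (sym (ℚΣ.∑-distrib-+ (λ w → sumTo i (λ k → h k w)) (h (suc i))))

  timesExpCoeff-cong : ∀ {p q} → (∀ k → p k ≡ q k) → ∀ i → timesExpCoeff p i ≡ timesExpCoeff q i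
  timesExpCoeff-cong p≗q i = sumTo-cong i (λ k _ → cong (_* invFact (i ∸ k)) (p≗q k))

  timesExpCoeff-+ : ∀ p q i → timesExpCoeff (λ k → p k + q k) i ≡ timesExpCoeff p i + timesExpCoeff q i
  timesExpCoeff-+ p q i = trans (sumTo-cong i (λ k _ → ℚ.*-distribʳ-+ (invFact (i ∸ k)) (p k) (q k)))
    (sumTo-distrib-+ i _ _)

  timesExpCoeff-∑ : ∀ {m} (p : Fin m → Poly) i →
                    timesExpCoeff (λ k → ℚΣ.sum (λ w → p w k)) i ≡ ℚΣ.sum (λ w → timesExpCoeff (p w) i)
  timesExpCoeff-∑ p i = trans (sumTo-cong i (λ k _ → ℚΣ.*-distribʳ-sum (invFact (i ∸ k)) (λ w → p w k)))
    (sumTo-∑-comm i (λ k w → p w k * invFact (i ∸ k)))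

  timesExpCoeff-zero : ∀ i → timesExpCoeff (λ _ → 0ℚ) i ≡ 0ℚ
  timesExpCoeff-zero i = trans (sumTo-cong i (λ k _ → ℚ.*-zeroˡ (invFact (i ∸ k)))) (sumTo-zero i)

  timesExpCoeff-constantTerm : ∀ p → timesExpCoeff p 0 ≡ p 0
  timesExpCoeff-constantTerm p = ℚ.*-identityʳ (p 0)

  -- (p e^X)' = (p' + p) e^X, read off at the coefficient of X^i.
  timesExpCoeff-deriv : ∀ p i →
    ℕ→ℚ (suc i) * timesExpCoeff p (suc i) ≡ timesExpCoeff (deriv p) i + timesExpCoeff p i
  timesExpCoeff-deriv p i = begin
    ℕ→ℚ (suc i) * sumTo (suc i) term                        ≡⟨ *-distribˡ-sumTo (suc i) (ℕ→ℚ (suc i)) term ⟩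
    sumTo (suc i) (λ k → ℕ→ℚ (suc i) * term k)              ≡⟨ sumTo-cong (suc i) split ⟩
    sumTo (suc i) (λ k → lower k + upper k)                 ≡⟨ sumTo-distrib-+ (suc i) lower upper ⟩
    sumTo (suc i) lower + sumTo (suc i) upper               ≡⟨ cong₂ _+_ lower-sum upper-sum ⟩
    timesExpCoeff (deriv p) i + timesExpCoeff p i           ∎
    where
    open ≡-Reasoning
    term lower upper : ℕ → ℚ
    term k = p k * invFact (suc i ∸ k)
    lower k = ℕ→ℚ k * term k
    upper k = ℕ→ℚ (suc i ∸ k) * term k

    split : ∀ k → k ≤ suc i → ℕ→ℚ (suc i) * term k ≡ lower k + upper k
    split k k≤1+i = begin
      ℕ→ℚ (suc i) * term k                 ≡⟨ cong (λ m → ℕ→ℚ m * term k) (ℕ.m+[n∸m]≡n k≤1+i) ⟨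
      ℕ→ℚ (k ℕ.+ (suc i ∸ k)) * term k     ≡⟨ cong (_* term k) (ℕ→ℚ-+ k (suc i ∸ k)) ⟩
      (ℕ→ℚ k + ℕ→ℚ (suc i ∸ k)) * term k   ≡⟨ ℚ.*-distribʳ-+ (term k) (ℕ→ℚ k) _ ⟩
      lower k + upper k                     ∎

    lower-sum : sumTo (suc i) lower ≡ timesExpCoeff (deriv p) i
    lower-sum = begin
      sumTo (suc i) lower                   ≡⟨ sumTo-unshift i lower ⟩
      0ℚ * term 0 + sumTo i (lower ∘ suc)   ≡⟨ cong (_+ sumTo i (lower ∘ suc)) (ℚ.*-zeroˡ (term 0)) ⟩
      0ℚ + sumTo i (lower ∘ suc)            ≡⟨ ℚ.+-identityˡ _ ⟩
      sumTo i (lower ∘ suc)                 ≡⟨ sumTo-cong i (λ k _ → ℚ.*-assoc (ℕ→ℚ (suc k)) (p (suc k)) _) ⟨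
      timesExpCoeff (deriv p) i             ∎

    upper-below : ∀ k → k ≤ i → upper k ≡ p k * invFact (i ∸ k)
    upper-below k k≤i = begin
      ℕ→ℚ (suc i ∸ k) * term k                          ≡⟨ cong (λ m → ℕ→ℚ m * (p k * invFact m)) (ℕ.+-∸-assoc 1 k≤i) ⟩
      ℕ→ℚ (suc (i ∸ k)) * (p k * invFact (suc (i ∸ k)))  ≡⟨ x∙yz≈y∙xz (ℕ→ℚ (suc (i ∸ k))) (p k) _ ⟩
      p k * (ℕ→ℚ (suc (i ∸ k)) * invFact (suc (i ∸ k)))  ≡⟨ cong (p k *_) (suc-*-egfCoeff 1 (i ∸ k)) ⟩
      p k * invFact (i ∸ k)                              ∎

    upper-top : upper (suc i) ≡ 0ℚ
    upper-top = begin
      ℕ→ℚ (i ∸ i) * term (suc i)   ≡⟨ cong (λ m → ℕ→ℚ m * term (suc i)) (ℕ.n∸n≡0 i) ⟩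
      0ℚ * term (suc i)            ≡⟨ ℚ.*-zeroˡ (term (suc i)) ⟩
      0ℚ                           ∎

    upper-sum : sumTo (suc i) upper ≡ timesExpCoeff p i
    upper-sum = begin
      sumTo i upper + upper (suc i)   ≡⟨ cong₂ _+_ (sumTo-cong i upper-below) upper-top ⟩
      timesExpCoeff p i + 0ℚ          ≡⟨ ℚ.+-identityʳ _ ⟩
      timesExpCoeff p i               ∎

  timesExpCoeff-injective : ∀ {p q} → (∀ i → timesExpCoeff p i ≡ timesExpCoeff q i) → ∀ k → p k ≡ q k
  timesExpCoeff-injective {p} {q} pe≗qe zero =
    trans (sym (timesExpCoeff-constantTerm p)) (trans (pe≗qe 0) (timesExpCoeff-constantTerm q))
  timesExpCoeff-injective {p} {q} pe≗qe (suc k) =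
    ℕ→ℚ-suc-*-cancelˡ k {p (suc k)} {q (suc k)} (timesExpCoeff-injective {deriv p} {deriv q} p′e≗q′e k)
    where
    p′e≗q′e : ∀ i → timesExpCoeff (deriv p) i ≡ timesExpCoeff (deriv q) i
    p′e≗q′e i = ∙-cancelʳ (timesExpCoeff p i) _ _ (begin
      timesExpCoeff (deriv p) i + timesExpCoeff p i   ≡⟨ timesExpCoeff-deriv p i ⟨
      ℕ→ℚ (suc i) * timesExpCoeff p (suc i)          ≡⟨ cong (ℕ→ℚ (suc i) *_) (pe≗qe (suc i)) ⟩
      ℕ→ℚ (suc i) * timesExpCoeff q (suc i)          ≡⟨ timesExpCoeff-deriv q i ⟩
      timesExpCoeff (deriv q) i + timesExpCoeff q i   ≡⟨ cong (_+_ (timesExpCoeff (deriv q) i)) (pe≗qe i) ⟨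
      timesExpCoeff (deriv q) i + timesExpCoeff p i   ∎)
      where open ≡-Reasoning

  egfCoeff-∑ : ∀ {m} (s : Fin m → ℕ) i → egfCoeff (ℕΣ.sum s) i ≡ ℚΣ.sum (λ w → egfCoeff (s w) i)
  egfCoeff-∑ {zero}  s i = ℚ.0/n≡0 (i !) {{i !≢0}}
  egfCoeff-∑ {suc m} s i =
    trans (egfCoeff-+ (s zero) _ i) (cong (_+_ (egfCoeff (s zero) i)) (egfCoeff-∑ (s ∘ suc) i))

  -- Σ s_i X^i / i! = p(X) exp(X). Callers pass s and p explicitly: inferring them would unfold
  -- egfCoeff and normalise fractions with symbolic numerators, which is prohibitively slow.
  EGFIsTimesExp : (ℕ → ℕ) → Poly → Set
  EGFIsTimesExp s p = ∀ i → egfCoeff (s i) i ≡ timesExpCoeff p i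

  EGFIsTimesExp-cong : ∀ {s s′ p q} → (∀ i → s i ≡ s′ i) → (∀ k → p k ≡ q k) →
                       EGFIsTimesExp s p → EGFIsTimesExp s′ q
  EGFIsTimesExp-cong s≗s′ p≗q egf i =
    trans (cong (λ a → egfCoeff a i) (sym (s≗s′ i))) (trans (egf i) (timesExpCoeff-cong p≗q i))

  EGFIsTimesExp-zero : EGFIsTimesExp (λ _ → 0) (λ _ → 0ℚ)
  EGFIsTimesExp-zero i = trans (ℚ.0/n≡0 (i !) {{i !≢0}}) (sym (timesExpCoeff-zero i))

  EGFIsTimesExp-∑ : ∀ {m} {s : Fin m → ℕ → ℕ} {p : Fin m → Poly} → (∀ w → EGFIsTimesExp (s w) (p w)) →
                    EGFIsTimesExp (λ i → ℕΣ.sum (λ w → s w i)) (λ k → ℚΣ.sum (λ w → p w k))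
  EGFIsTimesExp-∑ {s = s} {p} egf i = begin
    egfCoeff (ℕΣ.sum (λ w → s w i)) i              ≡⟨ egfCoeff-∑ (λ w → s w i) i ⟩
    ℚΣ.sum (λ w → egfCoeff (s w i) i)             ≡⟨ ℚΣ.sum-cong-≗ (λ w → egf w i) ⟩
    ℚΣ.sum (λ w → timesExpCoeff (p w) i)          ≡⟨ timesExpCoeff-∑ p i ⟨
    timesExpCoeff (λ k → ℚΣ.sum (λ w → p w k)) i  ∎
    where open ≡-Reasoning

  EGFIsTimesExp-shift : ∀ {s p} → EGFIsTimesExp s p → EGFIsTimesExp (λ i → s (suc i)) (λ k → p k + deriv p k)
  EGFIsTimesExp-shift {s} {p} egf i = begin
    egfCoeff (s (suc i)) i                                ≡⟨ suc-*-egfCoeff (s (suc i)) i ⟨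
    ℕ→ℚ (suc i) * egfCoeff (s (suc i)) (suc i)            ≡⟨ cong (ℕ→ℚ (suc i) *_) (egf (suc i)) ⟩
    ℕ→ℚ (suc i) * timesExpCoeff p (suc i)                 ≡⟨ timesExpCoeff-deriv p i ⟩
    timesExpCoeff (deriv p) i + timesExpCoeff p i         ≡⟨ ℚ.+-comm (timesExpCoeff (deriv p) i) _ ⟩
    timesExpCoeff p i + timesExpCoeff (deriv p) i         ≡⟨ timesExpCoeff-+ p (deriv p) i ⟨
    timesExpCoeff (λ k → p k + deriv p k) i               ∎
    where open ≡-Reasoning

  EGFIsTimesExp-integrate : ∀ {s r p} → ℕ→ℚ (s 0) ≡ p 0 → (∀ i → s (suc i) ≡ s i ℕ.+ r i) →
                            EGFIsTimesExp r (deriv p) → EGFIsTimesExp s p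
  EGFIsTimesExp-integrate {p = p} s₀≡p₀ _ _ zero = trans s₀≡p₀ (sym (timesExpCoeff-constantTerm p))
  EGFIsTimesExp-integrate {s} {r} {p} s₀≡p₀ s-step r-egf (suc i) =
    ℕ→ℚ-suc-*-cancelˡ i {egfCoeff (s (suc i)) (suc i)} {timesExpCoeff p (suc i)} (begin
      ℕ→ℚ (suc i) * egfCoeff (s (suc i)) (suc i)       ≡⟨ suc-*-egfCoeff (s (suc i)) i ⟩
      egfCoeff (s (suc i)) i                           ≡⟨ cong (λ a → egfCoeff a i) (s-step i) ⟩
      egfCoeff (s i ℕ.+ r i) i                         ≡⟨ egfCoeff-+ (s i) (r i) i ⟩
      egfCoeff (s i) i + egfCoeff (r i) i              ≡⟨ cong₂ _+_ (EGFIsTimesExp-integrate {s} {r} {p} s₀≡p₀ s-step r-egf i)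
                                                                    (r-egf i) ⟩
      timesExpCoeff p i + timesExpCoeff (deriv p) i    ≡⟨ ℚ.+-comm (timesExpCoeff p i) _ ⟩
      timesExpCoeff (deriv p) i + timesExpCoeff p i    ≡⟨ timesExpCoeff-deriv p i ⟨
      ℕ→ℚ (suc i) * timesExpCoeff p (suc i)            ∎)
    where open ≡-Reasoning

module Construction where

  open Counting
  open TimesExp
  open import Data.Integer using (+_)
  open import Data.Rational using (_+_; _*_; _/_)

  σ-singleton : (G : Digraph 1) → Simple G → σ G ≡ 1
  σ-singleton G G-simple = trans (σ-rec G) (cong (λ c → c ℕ.* σ (G ─ zero) ℕ.+ 0) (𝟙-yes (isMin? G zero) zero-min))
    where
    zero-min : IsMin G zero
    zero-min zero = G-simple zero

  module _ {m} (T : Digraph (suc m) → Fin (suc m) → Poly) (G : Digraph (suc (suc m))) (v w : Fin (suc (suc m))) where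

    recSummand-min : IsMin G w → (w≢v : w ≢ v) →
                     ∀ k → recSummand T G v w k ≡ T (G ─ w) (punchOut w≢v) k + deriv (T (G ─ w) (punchOut w≢v)) k
    recSummand-min w-min w≢v k with isMin? G w | w Fin.≟ v
    ... | yes _   | no w≢v′ = cong (λ j → T (G ─ w) j k + deriv (T (G ─ w) j) k) (Fin.punchOut-cong w refl)
    ... | yes _   | yes w≡v = contradiction w≡v w≢v
    ... | no ¬min | _       = contradiction w-min ¬min

    recSummand-other : ¬ (IsMin G w × w ≢ v) → ∀ k → recSummand T G v w k ≡ 0ℚ
    recSummand-other ¬min-other k with isMin? G w | w Fin.≟ v
    ... | yes w-min | no w≢v = contradiction (w-min , w≢v) ¬min-other
    ... | yes _     | yes _  = refl
    ... | no _      | _      = refl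

    recSummand-degree : (∀ (w≢v : w ≢ v) → DegLe (T (G ─ w) (punchOut w≢v)) m) →
                        ∀ k → m ℕ.< k → recSummand T G v w k ≡ 0ℚ
    recSummand-degree deg k m<k = cases (isMin? G w ×-dec ¬? (w Fin.≟ v))
      where
      open ≡-Reasoning
      cases : Dec (IsMin G w × w ≢ v) → recSummand T G v w k ≡ 0ℚ
      cases (no ¬min-other)     = recSummand-other ¬min-other k
      cases (yes (w-min , w≢v)) = begin
        recSummand T G v w k              ≡⟨ recSummand-min w-min w≢v k ⟩
        Tw k + ℕ→ℚ (suc k) * Tw (suc k)   ≡⟨ cong₂ (λ a b → a + ℕ→ℚ (suc k) * b) (deg w≢v k m<k)
                                              (deg w≢v (suc k) (ℕ.m<n⇒m<1+n m<k)) ⟩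
        0ℚ + ℕ→ℚ (suc k) * 0ℚ             ≡⟨ trans (ℚ.+-identityˡ _) (ℚ.*-zeroʳ (ℕ→ℚ (suc k))) ⟩
        0ℚ                                ∎
        where
        Tw : Poly
        Tw = T (G ─ w) (punchOut w≢v)

    recSummand-EGF : (∀ (w≢v : w ≢ v) →
                        EGFIsTimesExp (λ i → σ (ext (G ─ w) (punchOut w≢v) i)) (T (G ─ w) (punchOut w≢v))) →
                     EGFIsTimesExp (λ i → minDeletionCount G v w i) (λ k → recSummand T G v w k)
    recSummand-EGF egf = cases (isMin? G w ×-dec ¬? (w Fin.≟ v))
      where
      cases : Dec (IsMin G w × w ≢ v) → EGFIsTimesExp (λ i → minDeletionCount G v w i) (λ k → recSummand T G v w k)
      cases (yes (w-min , w≢v)) =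
        EGFIsTimesExp-cong {λ i → σ (ext (G ─ w) (punchOut w≢v) (suc i))} {λ i → minDeletionCount G v w i}
                           {λ k → T (G ─ w) (punchOut w≢v) k + deriv (T (G ─ w) (punchOut w≢v)) k} {λ k → recSummand T G v w k}
                           (sym ∘ minDeletionCount-min G v w w-min w≢v) (sym ∘ recSummand-min w-min w≢v)
                           (EGFIsTimesExp-shift {λ i → σ (ext (G ─ w) (punchOut w≢v) i)} {T (G ─ w) (punchOut w≢v)} (egf w≢v))
      cases (no ¬min-other) =
        EGFIsTimesExp-cong {λ _ → 0} {λ i → minDeletionCount G v w i} {λ _ → 0ℚ} {λ k → recSummand T G v w k}
                           (sym ∘ minDeletionCount-other G v w ¬min-other) (sym ∘ recSummand-other ¬min-other)
                           EGFIsTimesExp-zero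

  T : ∀ {n} → Digraph (suc n) → Fin (suc n) → Poly
  T {zero}  G v         = const 1ℚ
  T {suc m} G v zero    = ℕ→ℚ (σ G)
  T {suc m} G v (suc k) = (+ 1 / suc k) * ℚΣ.sum (λ w → recSummand T G v w k)

  deriv-T : ∀ {m} (G : Digraph (suc (suc m))) v k → deriv (T G v) k ≡ ℚΣ.sum (λ w → recSummand T G v w k)
  deriv-T G v k = begin
    ℕ→ℚ (suc k) * ((+ 1 / suc k) * S)   ≡⟨ ℚ.*-assoc (ℕ→ℚ (suc k)) _ S ⟨
    ℕ→ℚ (suc k) * (+ 1 / suc k) * S     ≡⟨ cong (_* S) (ℕ→ℚ-suc-*-inverse k) ⟩
    1ℚ * S                              ≡⟨ ℚ.*-identityˡ S ⟩
    S                                   ∎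
    where
    open ≡-Reasoning
    S : ℚ
    S = ℚΣ.sum (λ w → recSummand T G v w k)

  T-isT : ∀ {n} (G : Digraph (suc n)) v → Simple G → IsT G v (T G v)
  T-isT {zero} G zero G-simple = degree ,
    EGFIsTimesExp-integrate {λ i → σ (ext G zero i)} {λ _ → 0} {const 1ℚ} σ₀ step r-egf
    where
    degree : DegLe (const 1ℚ) 0
    degree (suc k) _ = refl
    σ₀ : ℕ→ℚ (σ (ext G zero 0)) ≡ 1ℚ
    σ₀ = cong ℕ→ℚ (trans (σ-ext-zero G zero) (σ-singleton G G-simple))
    step : ∀ i → σ (ext G zero (suc i)) ≡ σ (ext G zero i) ℕ.+ 0
    step i = trans (σ-ext-suc G zero i)
      (cong (λ c → σ (ext G zero i) ℕ.+ (c ℕ.+ 0)) (minDeletionCount-other G zero zero (λ (_ , 0≢0) → 0≢0 refl) i))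
    r-egf : EGFIsTimesExp (λ _ → 0) (deriv (const 1ℚ))
    r-egf = EGFIsTimesExp-cong {λ _ → 0} {λ _ → 0} {λ _ → 0ℚ} {deriv (const 1ℚ)}
              (λ _ → refl) (λ k → sym (ℚ.*-zeroʳ (ℕ→ℚ (suc k)))) EGFIsTimesExp-zero
  T-isT {suc m} G v G-simple = degree ,
    EGFIsTimesExp-integrate {λ i → σ (ext G v i)} {r} {T G v} (cong ℕ→ℚ (σ-ext-zero G v)) (σ-ext-suc G v) r-egf
    where
    IH : ∀ w (w≢v : w ≢ v) → IsT (G ─ w) (punchOut w≢v) (T (G ─ w) (punchOut w≢v))
    IH w w≢v = T-isT (G ─ w) (punchOut w≢v) (G-simple ∘ punchIn w)
    degree : DegLe (T G v) (suc m)
    degree (suc k) (s≤s m<k) = begin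
      (+ 1 / suc k) * ℚΣ.sum (λ w → recSummand T G v w k)   ≡⟨ cong ((+ 1 / suc k) *_) (ℚΣ.sum-cong-≗ λ w →
                                                                 recSummand-degree T G v w (proj₁ ∘ IH w) k m<k) ⟩
      (+ 1 / suc k) * ℚΣ.sum {suc (suc m)} (λ _ → 0ℚ)       ≡⟨ cong ((+ 1 / suc k) *_) (ℚΣ.sum-replicate-zero (suc (suc m))) ⟩
      (+ 1 / suc k) * 0ℚ                                     ≡⟨ ℚ.*-zeroʳ (+ 1 / suc k) ⟩
      0ℚ                                                     ∎
      where open ≡-Reasoning
    r : ℕ → ℕ
    r i = ℕΣ.sum (λ w → minDeletionCount G v w i)
    r-egf : EGFIsTimesExp r (deriv (T G v))
    r-egf = EGFIsTimesExp-cong {r} {r} {λ k → ℚΣ.sum (λ w → recSummand T G v w k)} {deriv (T G v)}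
              (λ _ → refl) (sym ∘ deriv-T G v)
              (EGFIsTimesExp-∑ {s = λ w i → minDeletionCount G v w i} {p = λ w k → recSummand T G v w k}
                (λ w → recSummand-EGF T G v w (proj₂ ∘ IH w)))

open Counting
open TimesExp
open Construction

mainTheorem6 :
  Σ (∀ {n : ℕ} → Digraph (suc n) → Fin (suc n) → Poly) λ T →
    -- existence: T_{G,v} has degree ≤ n-1 and satisfies the EGF identity
    (∀ {n : ℕ} (G : Digraph (suc n)) (v : Fin (suc n)) → Simple G → IsT G v (T G v))
    -- uniqueness
    × (∀ {n : ℕ} (G : Digraph (suc n)) (v : Fin (suc n)) → Simple G →
         ∀ (p : Poly) → IsT G v p → ∀ k → p k ≡ T G v k)
    -- T_{P₁,v} = 1
    × (∀ k → T P₁ zero k ≡ const 1ℚ k)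
    -- recurrence for n ≥ 2
    × (∀ {m : ℕ} (G : Digraph (suc (suc m))) (v : Fin (suc (suc m))) → Simple G →
         (∀ k → deriv (T G v) k ≡ sumFin (λ w → recSummand T G v w k))
         × T G v 0 ≡ ℕ→ℚ (σ G))
mainTheorem6 = T , T-isT , unique , (λ k → refl) , recurrence
  where
  unique : ∀ {n} (G : Digraph (suc n)) v → Simple G → ∀ p → IsT G v p → ∀ k → p k ≡ T G v k
  unique G v G-simple p (_ , p-egf) =
    timesExpCoeff-injective (λ i → trans (sym (p-egf i)) (proj₂ (T-isT G v G-simple) i))
  recurrence : ∀ {m} (G : Digraph (suc (suc m))) v → Simple G →
               (∀ k → deriv (T G v) k ≡ sumFin (λ w → recSummand T G v w k)) × T G v 0 ≡ ℕ→ℚ (σ G)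
  recurrence G v _ = (λ k → trans (deriv-T G v k) (sym (sumFin≡∑ (λ w → recSummand T G v w k)))) , refl
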